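{- Let $1\le m<n$ and let $K_n$ be the complete graph on $n$ vertices $v_1,\dots,v_n$. The eigenvectors of the $m$-Laplacian $L^{(m)}_{K_n}$ are \[ \mathbf{v}_j=(1,\omega^j,\omega^{2j},\dots,\omega^{(n-1)j})^T,\qquad j=0,1,\dots,n-1, \] where $\omega=\exp(2\pi i/n)$, with corresponding eigenvalues \[ \lambda_j=\begin{cases}0 & \text{if } j=0,\\ n\sum_{k=1}^m a_{k,m}(k-1)!\binom{n-2}{k-1} & \text{otherwise.}\end{cases} \]
   Context: For a positive integer $m$, $(a_{1,m},\dots,a_{m,m})$ denotes the unique solution of the linear system $\sum_{k=1}^m k^{2j}a_{k,m}=1$ if $j=1$ and $=0$ for $2\le j\le m$ (explicitly $a_{k,m}=(-1)^{k+1}\frac{2\binom{2m}{m-k}}{k^2\binom{2m}{m}}$). For a simple graph $G$ on vertices $v_1,\dots,v_n$ and $1\le k<n$, $P_{G,k}$ is the $n\times n$ matrix whose $(i,j)$ entry is the number of paths of length $k$ from $v_i$ to $v_j$ with $v_i\neq v_j$, where a path of length $k$ is a sequence of $k+1$ distinct vertices with consecutive vertices adjacent (so the diagonal of $P_{G,k}$ is zero). For $1\le m<n$, $G_m$ is the edge-weighted (possibly negatively weighted) graph with adjacency matrix $W=\sum_{k=1}^m a_{k,m}P_{G,k}$, and the $m$-Laplacian of $G$ is $L^{(m)}_G=D_W-W$, where $D_W$ is the diagonal matrix whose $(i,i)$ entry is the sum of the $i$th row of $W$. -}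

module Defs where

open import Level using (Level)
open import Data.Bool using (Bool; true; false; if_then_else_; not; _∧_)
open import Data.Nat as ℕ using (ℕ; zero; suc; _∸_)
open import Data.Nat.Combinatorics using (_C_)
open import Data.Nat using (_!)
open import Data.Fin using (Fin; toℕ)
open import Data.Fin.Properties using (_≟_)
open import Data.List using (List; []; _∷_; map; foldr; allFin; upTo)
open import Data.Bool.ListAction using (any)
open import Data.Integer using (ℤ; +_; -_)
open import Data.Rational using (ℚ; _/_; 0ℚ; _+_; _*_; _-_)
open import Relation.Nullary.Decidable using (⌊_⌋)
open import Relation.Binary.PropositionalEquality using (_≡_)
open import Algebra.Bundles using (CommutativeRing)

-- Finite simple graphs on the vertex set Fin n (v_1,…,v_n ↦ 0,…,n-1)

record SimpleGraph (n : ℕ) : Set where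
  field
    adj     : Fin n → Fin n → Bool
    symm    : ∀ i j → adj i j ≡ adj j i
    irrefl  : ∀ i → adj i i ≡ false

complete : (n : ℕ) → SimpleGraph n
complete n = record
  { adj = λ i j → not ⌊ i ≟ j ⌋
  ; symm = symm
  ; irrefl = irrefl }
  where
  open import Relation.Binary.PropositionalEquality using (refl)
  open import Relation.Nullary using (yes; no)
  open import Relation.Binary.PropositionalEquality using (sym)
  symm : ∀ i j → not ⌊ i ≟ j ⌋ ≡ not ⌊ j ≟ i ⌋
  symm i j with i ≟ j | j ≟ i
  ... | yes _ | yes _ = refl
  ... | no _  | no _  = refl
  ... | yes p | no q  = Data.Empty.⊥-elim (q (sym p)) where import Data.Empty
  ... | no p  | yes q = Data.Empty.⊥-elim (p (sym q)) where import Data.Empty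
  irrefl : ∀ i → not ⌊ i ≟ i ⌋ ≡ false
  irrefl i with i ≟ i
  ... | yes _ = refl
  ... | no ¬p = Data.Empty.⊥-elim (¬p refl) where import Data.Empty

-- Counting paths.  pathsFrom G vis cur k t = number of sequences
-- cur = u_0, u_1, …, u_k = t  of vertices, pairwise distinct and distinct
-- from all vertices in vis, with u_{r} adjacent to u_{r+1}.

sumℕ : List ℕ → ℕ
sumℕ = foldr ℕ._+_ 0

pathsFrom : ∀ {n} → SimpleGraph n → List (Fin n) → Fin n → ℕ → Fin n → ℕ
pathsFrom {n} G vis cur zero    t = if ⌊ cur ≟ t ⌋ then 1 else 0
pathsFrom {n} G vis cur (suc k) t =
  sumℕ (map (λ v → if SimpleGraph.adj G cur v ∧ not (any (λ w → ⌊ w ≟ v ⌋) (cur ∷ vis))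
                   then pathsFrom G (cur ∷ vis) v k t else 0)
            (allFin n))

P : ∀ {n} → SimpleGraph n → ℕ → Fin n → Fin n → ℕ
P G k i j = if ⌊ i ≟ j ⌋ then 0 else pathsFrom G [] i k j

sumℚ : List ℚ → ℚ
sumℚ = foldr _+_ 0ℚ

ℕtoℚ : ℕ → ℚ
ℕtoℚ k = (+ k) / 1

-- num / den, for den ≠ 0 (den = 0 gives 0; never used below)
frac : ℤ → ℕ → ℚ
frac z zero    = 0ℚ
frac z (suc d) = z / suc d

-- a_{k,m} = (-1)^{k+1} · 2·C(2m, m-k) / (k² · C(2m, m))   (1 ≤ k ≤ m)
a : ℕ → ℕ → ℚ
a k m = frac (sign k (+ (2 ℕ.* ((2 ℕ.* m) C (m ∸ k)))))
             (k ℕ.* k ℕ.* ((2 ℕ.* m) C m))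
  where
  sign : ℕ → ℤ → ℤ
  sign zero          z = - z
  sign (suc zero)    z = z
  sign (suc (suc r)) z = sign r z

oneTo : ℕ → List ℕ
oneTo m = map suc (upTo m)

W : ∀ {n} → SimpleGraph n → ℕ → Fin n → Fin n → ℚ
W G m i j = sumℚ (map (λ k → a k m * ℕtoℚ (P G k i j)) (oneTo m))

laplacian : ∀ {n} → SimpleGraph n → ℕ → Fin n → Fin n → ℚ
laplacian {n} G m i j =
  (if ⌊ i ≟ j ⌋ then sumℚ (map (W G m i) (allFin n)) else 0ℚ) - W G m i j

eigenvalue : ℕ → ℕ → ℕ → ℚ
eigenvalue n m zero    = 0ℚ
eigenvalue n m (suc _) =
  ℕtoℚ n * sumℚ (map (λ k → a k m * ℕtoℚ (((k ∸ 1) !) ℕ.* ((n ∸ 2) C (k ∸ 1)))) (oneTo m))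

module RingOps {c ℓ : Level} (R : CommutativeRing c ℓ) where
  open CommutativeRing R using (Carrier; 1#; 0#) renaming (_*_ to _·_; _+_ to _⊕_)

  pow : Carrier → ℕ → Carrier
  pow x zero    = 1#
  pow x (suc k) = x · pow x k

  sumR : List Carrier → Carrier
  sumR = foldr _⊕_ 0#

{-# OPTIONS --safe #-}
module Submission where

-- In K_n a path of length k between distinct vertices is an ordered choice of its
-- k − 1 inner vertices among the other n − 2, so P_{K_n,k} = (k − 1)!·C(n − 2, k − 1)·(J − I).
-- Hence W = w·(J − I) for the scalar w = weight n m, and L^{(m)} = w·(n I − J).
-- For j ≠ 0 the entries of v_j are the powers of the nontrivial n-th root of unity ω^j,
-- whose geometric sum vanishes since ω^j − 1 is invertible; so J v_j = 0 and
-- L v_j = n w v_j, while J v_0 = n v_0 gives L v_0 = 0.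

open import Defs
open import Data.Nat using (ℕ; _≤_; _<_) renaming (_*_ to _*ℕ_)
open import Data.Fin using (Fin; toℕ)
open import Data.List using (map; allFin)
open import Data.Product using (_×_; ∃)
open import Relation.Nullary using (¬_)
open import Data.Rational using (ℚ)
open import Data.Rational.Properties using (+-*-commutativeRing)
open import Algebra.Bundles using (CommutativeRing)
open import Algebra.Morphism.Structures using (module RingMorphisms)

import Algebra.Properties.Semiring.Sum as SemiringSum
open import Data.Bool using (Bool; true; false; if_then_else_; not; _∧_)
open import Data.Bool.ListAction using (any)
open import Data.Bool.Properties using (if-eta; ∨-zeroʳ)
open import Data.Fin using (zero; suc; punchIn)
open import Data.Fin.Properties using (_≟_; punchInᵢ≢i; toℕ<n)
open import Data.Integer using (+_)
import Data.Integer as ℤ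
import Data.Integer.Properties as ℤ
open import Data.List using (List; []; _∷_; foldr; tabulate; upTo)
open import Data.List.Properties using (map-tabulate; map-cong; map-∘)
import Data.Nat as ℕ
open import Data.Nat using (zero; suc; _∸_; _!)
import Data.Nat.Properties as ℕ
open import Data.Nat.Combinatorics using (_C_; nC1≡n; nCk+nC[k+1]≡[n+1]C[k+1])
open import Data.Nat.Coprimality using (1-coprimeTo) renaming (sym to Coprime-sym)
open import Data.Product using (_,_; proj₁; proj₂)
open import Data.Rational using (mkℚ; 0ℚ; 1ℚ; _/_)
import Data.Rational as ℚ
import Data.Rational.Properties as ℚ
import Data.Vec.Functional as Vector
open import Function using (_∘_; id)
open import Relation.Nullary.Decidable using (⌊_⌋; isYes)
import Relation.Binary.PropositionalEquality as ≡
open ≡ using (_≡_; _≢_; ≡-≟-identity; ≢-≟-identity; module ≡-Reasoning)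
open import Algebra.Properties.CommutativeSemigroup ℕ.*-commutativeSemigroup using (x∙yz≈y∙xz)

module ℕΣ = SemiringSum ℕ.+-*-semiring

foldr-tabulate : ∀ {a b} {A : Set a} {B : Set b} (_∙_ : A → B → B) (e : B) {n} (f : Fin n → A) →
                 foldr _∙_ e (tabulate f) ≡ Vector.foldr _∙_ e f
foldr-tabulate _∙_ e {zero}  f = ≡.refl
foldr-tabulate _∙_ e {suc n} f = ≡.cong (f zero ∙_) (foldr-tabulate _∙_ e (f ∘ suc))

foldr-map-allFin : ∀ {a b} {A : Set a} {B : Set b} (_∙_ : A → B → B) (e : B) {n} (f : Fin n → A) →
                   foldr _∙_ e (map f (allFin n)) ≡ Vector.foldr _∙_ e f
foldr-map-allFin _∙_ e f = ≡.trans (≡.cong (foldr _∙_ e) (map-tabulate id f)) (foldr-tabulate _∙_ e f)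

⌊≟⌋-refl : ∀ {n} (i : Fin n) → ⌊ i ≟ i ⌋ ≡ true
⌊≟⌋-refl i = ≡.cong isYes (≡-≟-identity _≟_ ≡.refl)

⌊≟⌋-≢ : ∀ {n} {i j : Fin n} → i ≢ j → ⌊ i ≟ j ⌋ ≡ false
⌊≟⌋-≢ i≢j = ≡.cong isYes (≢-≟-identity _≟_ i≢j)

[1+k]*[1+n]C[1+k]≡[1+n]*nCk : ∀ n k → suc k ℕ.* (suc n C suc k) ≡ suc n ℕ.* (n C k)
[1+k]*[1+n]C[1+k]≡[1+n]*nCk zero    zero    = ≡.refl
[1+k]*[1+n]C[1+k]≡[1+n]*nCk zero    (suc k) = ℕ.*-zeroʳ (suc (suc k))
[1+k]*[1+n]C[1+k]≡[1+n]*nCk (suc n) zero    =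
  ≡.trans (ℕ.+-identityʳ _) (≡.trans (nC1≡n (suc (suc n))) (≡.sym (ℕ.*-identityʳ _)))
[1+k]*[1+n]C[1+k]≡[1+n]*nCk (suc n) (suc k) = begin
  suc (suc k) ℕ.* (suc (suc n) C suc (suc k))
    ≡⟨ ≡.cong (suc (suc k) ℕ.*_) (nCk+nC[k+1]≡[n+1]C[k+1] (suc n) (suc k)) ⟨
  suc (suc k) ℕ.* (A ℕ.+ B)
    ≡⟨ ℕ.*-distribˡ-+ (suc (suc k)) A B ⟩
  A ℕ.+ suc k ℕ.* A ℕ.+ suc (suc k) ℕ.* B
    ≡⟨ ℕ.+-assoc A _ _ ⟩
  A ℕ.+ (suc k ℕ.* A ℕ.+ suc (suc k) ℕ.* B)
    ≡⟨ ≡.cong (A ℕ.+_) (≡.cong₂ ℕ._+_ ([1+k]*[1+n]C[1+k]≡[1+n]*nCk n k)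
                                       ([1+k]*[1+n]C[1+k]≡[1+n]*nCk n (suc k))) ⟩
  A ℕ.+ (suc n ℕ.* (n C k) ℕ.+ suc n ℕ.* (n C suc k))
    ≡⟨ ≡.cong (A ℕ.+_) (ℕ.*-distribˡ-+ (suc n) (n C k) (n C suc k)) ⟨
  A ℕ.+ suc n ℕ.* (n C k ℕ.+ n C suc k)
    ≡⟨ ≡.cong (λ x → A ℕ.+ suc n ℕ.* x) (nCk+nC[k+1]≡[n+1]C[k+1] n k) ⟩
  suc (suc n) ℕ.* A ∎
  where
  open ≡-Reasoning
  A = suc n C suc k
  B = suc n C suc (suc k)

[1+k]!*nC[1+k]≡n*[k!*[n∸1]Ck] : ∀ n k → suc k ! ℕ.* (n C suc k) ≡ n ℕ.* (k ! ℕ.* ((n ∸ 1) C k))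
[1+k]!*nC[1+k]≡n*[k!*[n∸1]Ck] zero    k = ℕ.*-zeroʳ (suc k !)
[1+k]!*nC[1+k]≡n*[k!*[n∸1]Ck] (suc n) k = begin
  (suc k ℕ.* k !) ℕ.* (suc n C suc k)   ≡⟨ ℕ.*-assoc (suc k) (k !) _ ⟩
  suc k ℕ.* (k ! ℕ.* (suc n C suc k))   ≡⟨ x∙yz≈y∙xz (suc k) (k !) _ ⟩
  k ! ℕ.* (suc k ℕ.* (suc n C suc k))   ≡⟨ ≡.cong (k ! ℕ.*_) ([1+k]*[1+n]C[1+k]≡[1+n]*nCk n k) ⟩
  k ! ℕ.* (suc n ℕ.* (n C k))           ≡⟨ x∙yz≈y∙xz (k !) (suc n) _ ⟩
  suc n ℕ.* (k ! ℕ.* (n C k))           ∎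
  where open ≡-Reasoning

indicator : Bool → ℕ
indicator b = if b then 1 else 0

sum-ones : ∀ k → ℕΣ.sum {k} (λ _ → 1) ≡ k
sum-ones zero    = ≡.refl
sum-ones (suc k) = ≡.cong suc (sum-ones k)

-- Here and below graphs have suc n vertices, so that sum-remove can split off any vertex.
module CompleteGraphPaths (n : ℕ) where
  open ≡ using (refl; sym; trans; cong; cong₂)
  open ℕΣ using (sum; sum-remove; sum-cong-≗; sum-replicate-zero; *-distribʳ-sum)
  open ≡-Reasoning

  K : SimpleGraph (suc n)
  K = complete (suc n)

  fresh : List (Fin (suc n)) → Fin (suc n) → Bool
  fresh L v = not (any (λ w → ⌊ w ≟ v ⌋) L)

  #fresh : List (Fin (suc n)) → ℕ
  #fresh L = sum (indicator ∘ fresh L)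

  -- Paths of length k + 1 from the head of L to a fresh t that avoid L: an ordered
  -- choice of k inner vertices among the #fresh L − 1 fresh vertices other than t.
  pathCount : List (Fin (suc n)) → Fin (suc n) → ℕ → ℕ
  pathCount L t k = if fresh L t then k ! ℕ.* ((#fresh L ∸ 1) C k) else 0

  fresh-∷-self : ∀ v L → fresh (v ∷ L) v ≡ false
  fresh-∷-self v L rewrite ⌊≟⌋-refl v = refl

  fresh-∷-≢ : ∀ {v w} L → v ≢ w → fresh (v ∷ L) w ≡ fresh L w
  fresh-∷-≢ L v≢w rewrite ⌊≟⌋-≢ v≢w = refl

  fresh-∷-stale : ∀ v L t → fresh L t ≡ false → fresh (v ∷ L) t ≡ false
  fresh-∷-stale v L t stale with any (λ w → ⌊ w ≟ t ⌋) L
  ... | true = cong not (∨-zeroʳ ⌊ v ≟ t ⌋)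
  fresh-∷-stale v L t () | false

  adjacent-fresh : ∀ cur vis v → not ⌊ cur ≟ v ⌋ ∧ fresh (cur ∷ vis) v ≡ fresh (cur ∷ vis) v
  adjacent-fresh cur vis v with ⌊ cur ≟ v ⌋
  ... | true  = refl
  ... | false = refl

  #fresh-[] : #fresh [] ≡ suc n
  #fresh-[] = sum-ones (suc n)

  #fresh-remove : ∀ L v → fresh L v ≡ true → #fresh L ≡ suc (sum (indicator ∘ fresh L ∘ punchIn v))
  #fresh-remove L v v-fresh =
    trans (sum-remove {i = v} (indicator ∘ fresh L))
          (cong (λ b → indicator b ℕ.+ sum (indicator ∘ fresh L ∘ punchIn v)) v-fresh)

  #fresh-∷ : ∀ L v → fresh L v ≡ true → #fresh (v ∷ L) ≡ #fresh L ∸ 1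
  #fresh-∷ L v v-fresh = begin
    #fresh (v ∷ L)
      ≡⟨ sum-remove {i = v} (indicator ∘ fresh (v ∷ L)) ⟩
    indicator (fresh (v ∷ L) v) ℕ.+ sum (indicator ∘ fresh (v ∷ L) ∘ punchIn v)
      ≡⟨ cong₂ ℕ._+_ (cong indicator (fresh-∷-self v L))
                     (sum-cong-≗ λ u → cong indicator (fresh-∷-≢ L (punchInᵢ≢i v u ∘ sym))) ⟩
    sum (indicator ∘ fresh L ∘ punchIn v)
      ≡⟨ cong (_∸ 1) (#fresh-remove L v v-fresh) ⟨
    #fresh L ∸ 1 ∎

  pathCount-stale : ∀ L t k → fresh L t ≡ false → pathCount L t k ≡ 0
  pathCount-stale L t k = cong (if_then k ! ℕ.* ((#fresh L ∸ 1) C k) else 0)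

  pathCount-fresh : ∀ L t k → fresh L t ≡ true → pathCount L t k ≡ k ! ℕ.* ((#fresh L ∸ 1) C k)
  pathCount-fresh L t k = cong (if_then k ! ℕ.* ((#fresh L ∸ 1) C k) else 0)

  extensions : List (Fin (suc n)) → Fin (suc n) → ℕ → Fin (suc n) → ℕ
  extensions L t k v = if fresh L v then pathCount (v ∷ L) t k else 0

  ∑extensions-stale : ∀ L t k → fresh L t ≡ false → sum (extensions L t k) ≡ 0
  ∑extensions-stale L t k t-stale = begin
    sum (extensions L t k)    ≡⟨ sum-cong-≗ extension≡0 ⟩
    sum {suc n} (λ _ → 0)     ≡⟨ sum-replicate-zero (suc n) ⟩
    0                         ∎
    where
    extension≡0 : ∀ v → extensions L t k v ≡ 0
    extension≡0 v =
      trans (cong (if fresh L v then_else 0) (pathCount-stale (v ∷ L) t k (fresh-∷-stale v L t t-stale)))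
            (if-eta (fresh L v))

  ∑extensions-fresh : ∀ L t k → fresh L t ≡ true →
                      sum (extensions L t k) ≡ suc k ! ℕ.* ((#fresh L ∸ 1) C suc k)
  ∑extensions-fresh L t k t-fresh = begin
    sum (extensions L t k)
      ≡⟨ sum-remove {i = t} (extensions L t k) ⟩
    extensions L t k t ℕ.+ sum (extensions L t k ∘ punchIn t)
      ≡⟨ cong₂ ℕ._+_ extension-t≡0 (sum-cong-≗ extension-≢t) ⟩
    sum (λ u → indicator (fresh L (punchIn t u)) ℕ.* X)
      ≡⟨ *-distribʳ-sum X (indicator ∘ fresh L ∘ punchIn t) ⟨
    sum (indicator ∘ fresh L ∘ punchIn t) ℕ.* X
      ≡⟨ cong (λ c → (c ∸ 1) ℕ.* X) (#fresh-remove L t t-fresh) ⟨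
    (#fresh L ∸ 1) ℕ.* X
      ≡⟨ [1+k]!*nC[1+k]≡n*[k!*[n∸1]Ck] (#fresh L ∸ 1) k ⟨
    suc k ! ℕ.* ((#fresh L ∸ 1) C suc k) ∎
    where
    X = k ! ℕ.* ((#fresh L ∸ 1 ∸ 1) C k)
    extension-t≡0 : extensions L t k t ≡ 0
    extension-t≡0 =
      trans (cong (if fresh L t then_else 0) (pathCount-stale (t ∷ L) t k (fresh-∷-self t L)))
            (if-eta (fresh L t))
    extension-≢t : ∀ u → extensions L t k (punchIn t u) ≡ indicator (fresh L (punchIn t u)) ℕ.* X
    extension-≢t u with fresh L (punchIn t u) in v-fresh
    ... | false = refl
    ... | true  = begin
      pathCount (punchIn t u ∷ L) t k
        ≡⟨ pathCount-fresh (punchIn t u ∷ L) t k (trans (fresh-∷-≢ L (punchInᵢ≢i t u)) t-fresh) ⟩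
      k ! ℕ.* ((#fresh (punchIn t u ∷ L) ∸ 1) C k)
        ≡⟨ cong (λ c → k ! ℕ.* ((c ∸ 1) C k)) (#fresh-∷ L (punchIn t u) v-fresh) ⟩
      X
        ≡⟨ ℕ.*-identityˡ X ⟨
      1 ℕ.* X ∎

  ∑extensions : ∀ L t k → sum (extensions L t k) ≡ pathCount L t (suc k)
  ∑extensions L t k with fresh L t in t-fresh
  ... | false = ∑extensions-stale L t k t-fresh
  ... | true  = ∑extensions-fresh L t k t-fresh

  pathsFrom-suc : ∀ vis cur k t →
    pathsFrom K vis cur (suc k) t ≡ sum (λ v → if fresh (cur ∷ vis) v then pathsFrom K (cur ∷ vis) v k t else 0)
  pathsFrom-suc vis cur k t = trans (foldr-map-allFin ℕ._+_ 0 step) (sum-cong-≗ λ v →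
      cong (if_then pathsFrom K (cur ∷ vis) v k t else 0) (adjacent-fresh cur vis v))
    where
    step : Fin (suc n) → ℕ
    step v = if not ⌊ cur ≟ v ⌋ ∧ fresh (cur ∷ vis) v then pathsFrom K (cur ∷ vis) v k t else 0

  pathsFrom-complete : ∀ k vis cur t → pathsFrom K vis cur (suc k) t ≡ pathCount (cur ∷ vis) t k
  pathsFrom-complete zero vis cur t = begin
    pathsFrom K vis cur 1 t                    ≡⟨ pathsFrom-suc vis cur 0 t ⟩
    sum arrival                                ≡⟨ sum-remove {i = t} arrival ⟩
    arrival t ℕ.+ sum (arrival ∘ punchIn t)    ≡⟨ cong₂ ℕ._+_ arrival-t (sum-cong-≗ arrival-≢t) ⟩
    pathCount L t 0 ℕ.+ sum {n} (λ _ → 0)      ≡⟨ cong (pathCount L t 0 ℕ.+_) (sum-replicate-zero n) ⟩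
    pathCount L t 0 ℕ.+ 0                      ≡⟨ ℕ.+-identityʳ _ ⟩
    pathCount L t 0                            ∎
    where
    L = cur ∷ vis
    arrival : Fin (suc n) → ℕ
    arrival v = if fresh L v then indicator ⌊ v ≟ t ⌋ else 0
    arrival-t : arrival t ≡ indicator (fresh L t)
    arrival-t = cong (λ b → if fresh L t then indicator b else 0) (⌊≟⌋-refl t)
    arrival-≢t : ∀ u → arrival (punchIn t u) ≡ 0
    arrival-≢t u =
      trans (cong (λ b → if fresh L (punchIn t u) then indicator b else 0) (⌊≟⌋-≢ (punchInᵢ≢i t u)))
            (if-eta (fresh L (punchIn t u)))
  pathsFrom-complete (suc k) vis cur t = begin
    pathsFrom K vis cur (suc (suc k)) t
      ≡⟨ pathsFrom-suc vis cur (suc k) t ⟩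
    sum (λ v → if fresh L v then pathsFrom K L v (suc k) t else 0)
      ≡⟨ sum-cong-≗ (λ v → cong (if fresh L v then_else 0) (pathsFrom-complete k L v t)) ⟩
    sum (extensions L t k)
      ≡⟨ ∑extensions L t k ⟩
    pathCount L t (suc k) ∎
    where L = cur ∷ vis

  P-complete : ∀ k {i l} → i ≢ l → P K (suc k) i l ≡ k ! ℕ.* ((suc n ∸ 2) C k)
  P-complete k {i} {l} i≢l = begin
    P K (suc k) i l                       ≡⟨ cong (if_then 0 else pathsFrom K [] i (suc k) l) (⌊≟⌋-≢ i≢l) ⟩
    pathsFrom K [] i (suc k) l            ≡⟨ pathsFrom-complete k [] i l ⟩
    pathCount (i ∷ []) l k                ≡⟨ pathCount-fresh (i ∷ []) l k (fresh-∷-≢ [] i≢l) ⟩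
    k ! ℕ.* ((#fresh (i ∷ []) ∸ 1) C k)   ≡⟨ cong (λ c → k ! ℕ.* ((c ∸ 1) C k)) #fresh[i]≡n ⟩
    k ! ℕ.* ((suc n ∸ 2) C k)             ∎
    where
    #fresh[i]≡n : #fresh (i ∷ []) ≡ n
    #fresh[i]≡n = trans (#fresh-∷ [] i refl) (cong (_∸ 1) #fresh-[])

-- + k / 1 is normalised by a gcd computation; it only reduces once rewritten to mkℚ (+ k) 0.
ℕtoℚ-suc : ∀ k → ℕtoℚ (suc k) ≡ 1ℚ ℚ.+ ℕtoℚ k
ℕtoℚ-suc k = begin
  + suc k / 1                       ≡⟨ ≡.cong (λ z → (+ 1 ℤ.+ z) / 1) (ℤ.*-identityʳ (+ k)) ⟨
  1ℚ ℚ.+ mkℚ (+ k) 0 k-coprime-1    ≡⟨ ≡.cong (1ℚ ℚ.+_) (ℚ.↥p/↧p≡p (mkℚ (+ k) 0 k-coprime-1)) ⟨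
  1ℚ ℚ.+ ℕtoℚ k                     ∎
  where
  open ≡-Reasoning
  k-coprime-1 = Coprime-sym (1-coprimeTo k)

sumℚ-zero : ∀ {A : Set} (f : A → ℚ) → (∀ x → f x ≡ 0ℚ) → ∀ xs → sumℚ (map f xs) ≡ 0ℚ
sumℚ-zero f f≡0 []       = ≡.refl
sumℚ-zero f f≡0 (x ∷ xs) = ≡.cong₂ ℚ._+_ (f≡0 x) (sumℚ-zero f f≡0 xs)

W-diag : ∀ {n} (G : SimpleGraph n) m i → W G m i i ≡ 0ℚ
W-diag G m i = sumℚ-zero _ term≡0 (oneTo m)
  where
  term≡0 : ∀ k → a k m ℚ.* ℕtoℚ (P G k i i) ≡ 0ℚ
  term≡0 k rewrite ⌊≟⌋-refl i = ℚ.*-zeroʳ (a k m)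

laplacian-diag : ∀ {n} (G : SimpleGraph n) m i → laplacian G m i i ≡ sumℚ (map (W G m i) (allFin n))
laplacian-diag {n} G m i =
  ≡.trans (≡.cong₂ (λ b w → (if b then D else 0ℚ) ℚ.- w) (⌊≟⌋-refl i) (W-diag G m i)) (ℚ.+-identityʳ D)
  where D = sumℚ (map (W G m i) (allFin n))

laplacian-off : ∀ {n} (G : SimpleGraph n) m {i l} → i ≢ l → laplacian G m i l ≡ ℚ.- W G m i l
laplacian-off G m i≢l rewrite ⌊≟⌋-≢ i≢l = ℚ.+-identityˡ _

weight : ℕ → ℕ → ℚ
weight n m = sumℚ (map (λ k → a k m ℚ.* ℕtoℚ ((k ∸ 1) ! ℕ.* ((n ∸ 2) C (k ∸ 1)))) (oneTo m))

W-complete : ∀ n m {i l : Fin (suc n)} → i ≢ l → W (complete (suc n)) m i l ≡ weight (suc n) m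
W-complete n m {i} {l} i≢l = ≡.cong sumℚ (begin
  map f (map suc (upTo m))   ≡⟨ map-∘ (upTo m) ⟨
  map (f ∘ suc) (upTo m)     ≡⟨ map-cong (λ k → ≡.cong (λ p → a (suc k) m ℚ.* ℕtoℚ p) (P-complete k i≢l))
                                          (upTo m) ⟩
  map (g ∘ suc) (upTo m)     ≡⟨ map-∘ (upTo m) ⟩
  map g (map suc (upTo m))   ∎)
  where
  open ≡-Reasoning
  open CompleteGraphPaths n using (P-complete)
  f g : ℕ → ℚ
  f k = a k m ℚ.* ℕtoℚ (P (complete (suc n)) k i l)
  g k = a k m ℚ.* ℕtoℚ ((k ∸ 1) ! ℕ.* ((suc n ∸ 2) C (k ∸ 1)))

module RingFacts {c ℓ} (F : CommutativeRing c ℓ) where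
  open CommutativeRing F
  open RingOps F using (pow)
  open import Algebra.Properties.Ring ring
    using (-‿distribʳ-*; -‿distribˡ-*; -‿involutive; +-inverseʳ-unique; +-cancelʳ; x∙y⁻¹≈ε⇒x≈y)
  open import Algebra.Properties.Semiring.Sum semiring public
    using (sum; sum-remove; sum-cong-≋; sum-replicate; *-distribˡ-sum)
  open import Algebra.Properties.Semiring.Exp semiring public using (_^_; ^-assocʳ; ^-congˡ)
  open import Algebra.Properties.Semiring.Mult semiring public
    using (×-congʳ; ×-comm-*; ×-assoc-*) renaming (_×_ to _·_)
  open import Algebra.Solver.Ring.NaturalCoefficients.Default commutativeSemiring using (solve; _:=_; _:+_; _:*_; con)
  open import Relation.Binary.Reasoning.Setoid setoid

  pow≡^ : ∀ x k → pow x k ≡ x ^ k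
  pow≡^ x zero    = ≡.refl
  pow≡^ x (suc k) = ≡.cong (x *_) (pow≡^ x k)

  1#^n≈1# : ∀ k → 1# ^ k ≈ 1#
  1#^n≈1# zero    = refl
  1#^n≈1# (suc k) = trans (*-identityˡ _) (1#^n≈1# k)

  powers : Carrier → (n : ℕ) → Vector.Vector Carrier n
  powers x n i = x ^ toℕ i

  -- (x − 1)·∑ xⁱ = xⁿ − 1 with the subtractions moved across, so that it is a semiring identity.
  x*∑x^i+1≈∑x^i+x^n : ∀ x n → x * sum (powers x n) + 1# ≈ sum (powers x n) + x ^ n
  x*∑x^i+1≈∑x^i+x^n x zero    = +-congʳ (zeroʳ x)
  x*∑x^i+1≈∑x^i+x^n x (suc n) = begin
    x * (1# + sum (λ (i : Fin n) → x ^ suc (toℕ i))) + 1#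
      ≈⟨ +-congʳ (*-congˡ (+-congˡ (*-distribˡ-sum x (powers x n)))) ⟨
    x * (1# + x * ∑x^i) + 1#
      ≈⟨ solve 2 (λ x s → x :* (con 1 :+ x :* s) :+ con 1 := x :* (x :* s :+ con 1) :+ con 1) refl x ∑x^i ⟩
    x * (x * ∑x^i + 1#) + 1#
      ≈⟨ +-congʳ (*-congˡ (x*∑x^i+1≈∑x^i+x^n x n)) ⟩
    x * (∑x^i + x ^ n) + 1#
      ≈⟨ solve 3 (λ x s p → x :* (s :+ p) :+ con 1 := (con 1 :+ x :* s) :+ x :* p) refl x ∑x^i (x ^ n) ⟩
    (1# + x * ∑x^i) + x ^ suc n
      ≈⟨ +-congʳ (+-congˡ (*-distribˡ-sum x (powers x n))) ⟩
    (1# + sum (λ (i : Fin n) → x ^ suc (toℕ i))) + x ^ suc n ∎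
    where ∑x^i = sum (powers x n)

  module CompleteRow {n} (w : Carrier) (r : Vector.Vector Carrier (suc n)) (i : Fin (suc n))
                     (r-diag : r i ≈ n · w) (r-off : ∀ u → r (punchIn i u) ≈ - w) where

    row-* : ∀ x → sum (λ l → r l * x l) ≈ (n · w) * x i - w * sum (Vector.removeAt x i)
    row-* x = begin
      sum (λ l → r l * x l)
        ≈⟨ sum-remove {i = i} (λ l → r l * x l) ⟩
      r i * x i + sum (λ u → r (punchIn i u) * x (punchIn i u))
        ≈⟨ +-cong (*-congʳ r-diag) (sum-cong-≋ λ u → *-congʳ (r-off u)) ⟩
      (n · w) * x i + sum (λ u → - w * x (punchIn i u))
        ≈⟨ +-congˡ (*-distribˡ-sum (- w) (Vector.removeAt x i)) ⟨
      (n · w) * x i + - w * sum (Vector.removeAt x i)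
        ≈⟨ +-congˡ (-‿distribˡ-* w _) ⟨
      (n · w) * x i - w * sum (Vector.removeAt x i) ∎

    row-*-ones : ∀ x → (∀ l → x l ≈ 1#) → sum (λ l → r l * x l) ≈ 0#
    row-*-ones x x≈1 = begin
      sum (λ l → r l * x l)
        ≈⟨ row-* x ⟩
      (n · w) * x i - w * sum (Vector.removeAt x i)
        ≈⟨ +-cong (*-congˡ (x≈1 i)) (-‿cong (*-congˡ (sum-cong-≋ (x≈1 ∘ punchIn i)))) ⟩
      (n · w) * 1# - w * sum {n} (λ _ → 1#)
        ≈⟨ +-cong (*-identityʳ _) (-‿cong (*-congˡ (sum-replicate n))) ⟩
      n · w - w * (n · 1#)
        ≈⟨ +-congˡ (-‿cong (trans (×-comm-* n w 1#) (×-congʳ n (*-identityʳ w)))) ⟩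
      n · w - n · w
        ≈⟨ -‿inverseʳ _ ⟩
      0# ∎

    row-*-balanced : ∀ x → sum x ≈ 0# → sum (λ l → r l * x l) ≈ (suc n · w) * x i
    row-*-balanced x ∑x≈0 = begin
      sum (λ l → r l * x l)
        ≈⟨ row-* x ⟩
      (n · w) * x i - w * sum (Vector.removeAt x i)
        ≈⟨ +-congˡ (-‿cong (*-congˡ rest≈-xᵢ)) ⟩
      (n · w) * x i - w * - x i
        ≈⟨ +-congˡ (trans (-‿cong (sym (-‿distribʳ-* w (x i)))) (-‿involutive (w * x i))) ⟩
      (n · w) * x i + w * x i
        ≈⟨ trans (distribʳ (x i) w (n · w)) (+-comm _ _) ⟨
      (suc n · w) * x i ∎
      where
      rest≈-xᵢ : sum (Vector.removeAt x i) ≈ - x i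
      rest≈-xᵢ = +-inverseʳ-unique (x i) _ (trans (sym (sum-remove {i = i} x)) ∑x≈0)

  module _ (inverse : ∀ x → ¬ x ≈ 0# → ∃ λ y → x * y ≈ 1#) where

    x*y≈y⇒y≈0 : ∀ {x y} → ¬ x ≈ 1# → x * y ≈ y → y ≈ 0#
    x*y≈y⇒y≈0 {x} {y} x≉1 xy≈y = begin
      y                       ≈⟨ *-identityˡ y ⟨
      1# * y                  ≈⟨ *-congʳ (trans (*-comm z (x - 1#)) z-inverse) ⟨
      (z * (x - 1#)) * y      ≈⟨ *-assoc z _ y ⟩
      z * ((x - 1#) * y)      ≈⟨ *-congˡ [x-1]y≈0 ⟩
      z * 0#                  ≈⟨ zeroʳ z ⟩
      0#                      ∎
      where
      x-1≉0 : ¬ (x - 1#) ≈ 0#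
      x-1≉0 = x≉1 ∘ x∙y⁻¹≈ε⇒x≈y x 1#
      z = proj₁ (inverse (x - 1#) x-1≉0)
      z-inverse = proj₂ (inverse (x - 1#) x-1≉0)
      [x-1]y≈0 : (x - 1#) * y ≈ 0#
      [x-1]y≈0 = begin
        (x - 1#) * y          ≈⟨ distribʳ y x (- 1#) ⟩
        x * y + - 1# * y      ≈⟨ +-cong xy≈y (sym (-‿distribˡ-* 1# y)) ⟩
        y - 1# * y            ≈⟨ +-congˡ (-‿cong (*-identityˡ y)) ⟩
        y - y                 ≈⟨ -‿inverseʳ y ⟩
        0#                    ∎

    ∑x^i≈0 : ∀ {x} n → ¬ x ≈ 1# → x ^ n ≈ 1# → sum (powers x n) ≈ 0#
    ∑x^i≈0 {x} n x≉1 xⁿ≈1 = x*y≈y⇒y≈0 x≉1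
      (+-cancelʳ 1# (x * sum (powers x n)) (sum (powers x n))
        (trans (x*∑x^i+1≈∑x^i+x^n x n) (+-congˡ xⁿ≈1)))

module FromℚHomomorphism {c ℓ} (F : CommutativeRing c ℓ) (ι : ℚ → CommutativeRing.Carrier F)
  (ι-hom : RingMorphisms.IsRingHomomorphism (CommutativeRing.rawRing +-*-commutativeRing)
                                           (CommutativeRing.rawRing F) ι)
  where
  open CommutativeRing F
  open RingOps F using (sumR)
  open RingFacts F using (_·_)
  open RingMorphisms.IsRingHomomorphism ι-hom public

  ι-sum : ∀ {A : Set} (f : A → ℚ) xs → ι (sumℚ (map f xs)) ≈ sumR (map (ι ∘ f) xs)
  ι-sum f []       = 0#-homo
  ι-sum f (x ∷ xs) = trans (+-homo _ _) (+-congˡ (ι-sum f xs))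

  ι-ℕtoℚ : ∀ k → ι (ℕtoℚ k) ≈ k · 1#
  ι-ℕtoℚ zero    = 0#-homo
  ι-ℕtoℚ (suc k) = trans (⟦⟧-cong (ℕtoℚ-suc k)) (trans (+-homo _ _) (+-cong 1#-homo (ι-ℕtoℚ k)))

module CompleteGraphSpectrum {c ℓ} (F : CommutativeRing c ℓ) (ι : ℚ → CommutativeRing.Carrier F)
  (ι-hom : RingMorphisms.IsRingHomomorphism (CommutativeRing.rawRing +-*-commutativeRing)
                                           (CommutativeRing.rawRing F) ι)
  (n m : ℕ)
  where
  open CommutativeRing F hiding (zero)
  open RingOps F using (pow; sumR)
  open RingFacts F
  open FromℚHomomorphism F ι ι-hom
  open import Relation.Binary.Reasoning.Setoid setoid

  K : SimpleGraph (suc n)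
  K = complete (suc n)

  w : Carrier
  w = ι (weight (suc n) m)

  ι-laplacian-diag : ∀ i → ι (laplacian K m i i) ≈ n · w
  ι-laplacian-diag i = begin
    ι (laplacian K m i i)                              ≡⟨ ≡.cong ι (laplacian-diag K m i) ⟩
    ι (sumℚ (map (W K m i) (allFin (suc n))))          ≈⟨ ι-sum (W K m i) (allFin (suc n)) ⟩
    sumR (map (ι ∘ W K m i) (allFin (suc n)))          ≡⟨ foldr-map-allFin _+_ 0# (ι ∘ W K m i) ⟩
    sum (ι ∘ W K m i)                                  ≈⟨ sum-remove {i = i} (ι ∘ W K m i) ⟩
    ι (W K m i i) + sum (λ u → ι (W K m i (punchIn i u)))
      ≈⟨ +-cong (trans (⟦⟧-cong (W-diag K m i)) 0#-homo)
                (sum-cong-≋ λ u → ⟦⟧-cong (W-complete n m (punchInᵢ≢i i u ∘ ≡.sym))) ⟩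
    0# + sum {n} (λ _ → w)                             ≈⟨ +-identityˡ _ ⟩
    sum {n} (λ _ → w)                                  ≈⟨ sum-replicate n ⟩
    n · w                                              ∎

  ι-laplacian-off : ∀ i u → ι (laplacian K m i (punchIn i u)) ≈ - w
  ι-laplacian-off i u = begin
    ι (laplacian K m i (punchIn i u))   ≡⟨ ≡.cong ι (laplacian-off K m (punchInᵢ≢i i u ∘ ≡.sym)) ⟩
    ι (ℚ.- W K m i (punchIn i u))       ≈⟨ -‿homo _ ⟩
    - ι (W K m i (punchIn i u))         ≈⟨ -‿cong (⟦⟧-cong (W-complete n m (punchInᵢ≢i i u ∘ ≡.sym))) ⟩
    - w                                 ∎

  ι-eigenvalue : ∀ j → ι (eigenvalue (suc n) m (suc j)) ≈ suc n · w
  ι-eigenvalue j = begin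
    ι (ℕtoℚ (suc n) ℚ.* weight (suc n) m)   ≈⟨ *-homo _ _ ⟩
    ι (ℕtoℚ (suc n)) * w                    ≈⟨ *-congʳ (ι-ℕtoℚ (suc n)) ⟩
    (suc n · 1#) * w                        ≈⟨ ×-assoc-* (suc n) 1# w ⟩
    suc n · (1# * w)                        ≈⟨ ×-congʳ (suc n) (*-identityˡ w) ⟩
    suc n · w                               ∎

  module _ (inverse : ∀ x → ¬ x ≈ 0# → ∃ λ y → x * y ≈ 1#) (ω : Carrier) (ωⁿ≈1 : pow ω (suc n) ≈ 1#)
           (ωᵈ≉1 : ∀ d → 1 ≤ d → d < suc n → ¬ pow ω d ≈ 1#) where

    eigenvector : Fin (suc n) → Fin (suc n) → Carrier
    eigenvector j l = pow ω (toℕ l *ℕ toℕ j)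

    eigenvector-zero : ∀ l → eigenvector zero l ≈ 1#
    eigenvector-zero l = reflexive (≡.cong (pow ω) (ℕ.*-zeroʳ (toℕ l)))

    ∑eigenvector≈0 : ∀ (j : Fin n) → sum (eigenvector (suc j)) ≈ 0#
    ∑eigenvector≈0 j = begin
      sum (eigenvector (suc j))                     ≈⟨ sum-cong-≋ ω^[l*d]≈[ω^d]^l ⟩
      sum (powers (ω ^ d) (suc n))                  ≈⟨ ∑x^i≈0 inverse (suc n) ω^d≉1 [ω^d]ⁿ≈1 ⟩
      0#                                            ∎
      where
      d = suc (toℕ j)
      ω^[l*d]≈[ω^d]^l : ∀ (l : Fin (suc n)) → pow ω (toℕ l *ℕ d) ≈ (ω ^ d) ^ toℕ l
      ω^[l*d]≈[ω^d]^l l = begin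
        pow ω (toℕ l *ℕ d)   ≡⟨ pow≡^ ω (toℕ l *ℕ d) ⟩
        ω ^ (toℕ l *ℕ d)     ≡⟨ ≡.cong (ω ^_) (ℕ.*-comm (toℕ l) d) ⟩
        ω ^ (d *ℕ toℕ l)     ≈⟨ ^-assocʳ ω d (toℕ l) ⟨
        (ω ^ d) ^ toℕ l      ∎
      ω^d≉1 : ¬ ω ^ d ≈ 1#
      ω^d≉1 = ωᵈ≉1 d (ℕ.s≤s ℕ.z≤n) (ℕ.s≤s (toℕ<n j)) ∘ trans (reflexive (pow≡^ ω d))
      [ω^d]ⁿ≈1 : (ω ^ d) ^ suc n ≈ 1#
      [ω^d]ⁿ≈1 = begin
        (ω ^ d) ^ suc n      ≈⟨ ^-assocʳ ω d (suc n) ⟩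
        ω ^ (d *ℕ suc n)     ≡⟨ ≡.cong (ω ^_) (ℕ.*-comm d (suc n)) ⟩
        ω ^ (suc n *ℕ d)     ≈⟨ ^-assocʳ ω (suc n) d ⟨
        (ω ^ suc n) ^ d      ≈⟨ ^-congˡ d (trans (reflexive (≡.sym (pow≡^ ω (suc n)))) ωⁿ≈1) ⟩
        1# ^ d               ≈⟨ 1#^n≈1# d ⟩
        1#                   ∎

    eigen-equation : ∀ (j i : Fin (suc n)) →
      sumR (map (λ l → ι (laplacian K m i l) * eigenvector j l) (allFin (suc n)))
        ≈ ι (eigenvalue (suc n) m (toℕ j)) * eigenvector j i
    eigen-equation j i = trans (reflexive (foldr-map-allFin _+_ 0# (λ l → row l * eigenvector j l))) (L·v j)
      where
      row : Fin (suc n) → Carrier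
      row l = ι (laplacian K m i l)
      open CompleteRow w row i (ι-laplacian-diag i) (ι-laplacian-off i)
      L·v : ∀ j → sum (λ l → row l * eigenvector j l) ≈ ι (eigenvalue (suc n) m (toℕ j)) * eigenvector j i
      L·v zero    = begin
        sum (λ l → row l * eigenvector zero l)   ≈⟨ row-*-ones (eigenvector zero) eigenvector-zero ⟩
        0#                                       ≈⟨ zeroˡ _ ⟨
        0# * eigenvector zero i                  ≈⟨ *-congʳ 0#-homo ⟨
        ι 0ℚ * eigenvector zero i                ∎
      L·v (suc j) = begin
        sum (λ l → row l * eigenvector (suc j) l)   ≈⟨ row-*-balanced (eigenvector (suc j)) (∑eigenvector≈0 j) ⟩
        (suc n · w) * eigenvector (suc j) i         ≈⟨ *-congʳ (ι-eigenvalue (toℕ j)) ⟨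
        ι (eigenvalue (suc n) m (suc (toℕ j))) * eigenvector (suc j) i ∎

proposition4p3 : ∀ {c ℓ} (F : CommutativeRing c ℓ) →
  let open CommutativeRing F
      open RingOps F
  in ¬ (1# ≈ 0#) →
     (∀ x → ¬ (x ≈ 0#) → ∃ λ y → x * y ≈ 1#) →
     (ι : ℚ → Carrier) →
     RingMorphisms.IsRingHomomorphism (CommutativeRing.rawRing +-*-commutativeRing) rawRing ι →
     (n m : ℕ) → 1 ≤ m → m < n →
     (ω : Carrier) → pow ω n ≈ 1# →
     (∀ d → 1 ≤ d → d < n → ¬ (pow ω d ≈ 1#)) →
     (j : Fin n) →
     ¬ (∀ (l : Fin n) → pow ω (toℕ l *ℕ toℕ j) ≈ 0#) ×
     (∀ (i : Fin n) →
        sumR (map (λ l → ι (laplacian (complete n) m i l) * pow ω (toℕ l *ℕ toℕ j)) (allFin n))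
        ≈ ι (eigenvalue n m (toℕ j)) * pow ω (toℕ i *ℕ toℕ j))
proposition4p3 F 1≉0 inverse ι ι-hom (suc n) m _ _ ω ωⁿ≈1 ωᵈ≉1 j =
  (λ vanishes → 1≉0 (vanishes zero)) , eigen-equation inverse ω ωⁿ≈1 ωᵈ≉1 j
  where open CompleteGraphSpectrum F ι ι-hom n m
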